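{- Let $\mathcal{C}$ be a hereditary graph class (closed under taking induced subgraphs), and suppose that for each positive integer $n$ some twisted chain graph of order $n$ belongs to $\mathcal{C}$. Then $\mathcal{C}$ does not admit low rank-width colorings.
   Context: All graphs are finite and simple. For a positive integer $n$, a twisted chain graph of order $n$ is a graph on $3n^2$ vertices $A\cup B\cup C$ with $A=\{v_1,\dots,v_{n^2}\}$, $B=\{w_1,\dots,w_{n^2}\}$, $C=\{z_{(i,j)}\colon 1\le i,j\le n\}$ such that: for all $x,y,i,j\in\{1,\dots,n\}$ and $k=n(x-1)+y$, $v_k$ is adjacent to $z_{(i,j)}$ iff ($x<i$) or ($x=i$ and $y\le j$); $w_k$ is adjacent to $z_{(i,j)}$ iff ($x<j$) or ($x=j$ and $y\le i$); and the edge relation within $A\cup B$ and within $C$ is arbitrary. Rank-width: for a graph $G$ and $X\subseteq V(G)$, $\mathrm{cutrk}_G(X)$ is the rank over GF(2) of the adjacency submatrix with rows $X$ and columns $V(G)\setminus X$; a rank-decomposition is a tree with all nodes of degree 1 or 3 whose leaves are in bijection with $V(G)$, an edge $e$ has width $\mathrm{cutrk}_G$ of the vertex set on one side of $e$, and the rank-width is the minimum over rank-decompositions of the maximum edge width ($0$ for graphs with at most one vertex). A class $\mathcal{D}$ of graphs admits low rank-width colorings if there exist functions $N,Q\colon\mathbb{N}\to\mathbb{N}$ such that for all $p\in\mathbb{N}$, every $G\in\mathcal{D}$ can be vertex colored with at most $N(p)$ colors such that the union of any $i\le p$ color classes induces a subgraph of rank-width at most $Q(i)$. -}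

module Defs where

open import Data.Nat using (ℕ; zero; suc; _+_; _*_; _≤_; _<ᵇ_; _≤ᵇ_; _≡ᵇ_)
open import Data.Bool using (Bool; true; false; _∧_; _∨_; _xor_)
open import Data.Fin using (Fin; zero; suc; toℕ; inject₁; fromℕ)
open import Data.Product using (Σ; ∃; _×_; _,_)
open import Data.Sum using (_⊎_; inj₁; inj₂)
open import Relation.Nullary using (¬_)
open import Relation.Binary.PropositionalEquality using (_≡_)
open import Function.Definitions using (Injective; Surjective)

record Graph : Set where
  field
    size : ℕ
    E    : Fin size → Fin size → Bool
    sym  : ∀ u v → E u v ≡ E v u
    irr  : ∀ u → E u u ≡ false
open Graph public

induced : (G : Graph) {m : ℕ} (f : Fin m → Fin (size G)) → Graph
induced G {m} f = record
  { size = m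
  ; E    = λ u v → E G (f u) (f v)
  ; sym  = λ u v → sym G (f u) (f v)
  ; irr  = λ u → irr G (f u) }

countTrue : ∀ {k} → (Fin k → Bool) → ℕ
countTrue {zero}  b = 0
countTrue {suc k} b with b zero
... | true  = suc (countTrue (λ i → b (suc i)))
... | false = countTrue (λ i → b (suc i))

parity : ∀ {k} → (Fin k → Bool) → Bool
parity {zero}  b = false
parity {suc k} b = b zero xor parity (λ i → b (suc i))

-- cut-rank over GF(2):  cutrk_G(X) ≤ r
-- i.e. any r+1 distinct rows (vertices of X) of the X × (V∖X) adjacency
-- matrix are linearly dependent over GF(2).

CutRk≤ : (G : Graph) → (Fin (size G) → Set) → ℕ → Set
CutRk≤ G X r =
  (f : Fin (suc r) → Fin (size G)) → Injective _≡_ _≡_ f → (∀ i → X (f i)) →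
  Σ (Fin (suc r) → Bool) λ c →
    (∃ λ i → c i ≡ true) ×
    (∀ v → ¬ X v → parity (λ i → c i ∧ E G (f i) v) ≡ false)

data Reach {t : ℕ} (R : Fin t → Fin t → Set) : Fin t → Fin t → Set where
  here : ∀ {x} → Reach R x x
  step : ∀ {x y z} → R x y → Reach R y z → Reach R x z

Adj : ∀ {t} → (Fin t → Fin t → Bool) → Fin t → Fin t → Set
Adj T x y = T x y ≡ true

AdjMinus : ∀ {t} → (Fin t → Fin t → Bool) → Fin t → Fin t → Fin t → Fin t → Set
AdjMinus T a b x y = (T x y ≡ true) × ¬ ((x ≡ a × y ≡ b) ⊎ (x ≡ b × y ≡ a))

-- a cycle of length m+3: distinct vertices c 0, …, c (m+2), consecutive ones
-- adjacent, and the last adjacent to the first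
HasCycle : ∀ {t} → (Fin t → Fin t → Bool) → Set
HasCycle {t} T = Σ ℕ λ m → Σ (Fin (suc (suc (suc m))) → Fin t) λ c →
  Injective _≡_ _≡_ c ×
  (∀ (i : Fin (suc (suc m))) → T (c (inject₁ i)) (c (suc i)) ≡ true) ×
  (T (c (fromℕ (suc (suc m)))) (c zero) ≡ true)

degree : ∀ {t} → (Fin t → Fin t → Bool) → Fin t → ℕ
degree T x = countTrue (T x)

record RankDecomposition (G : Graph) : Set where
  field
    t        : ℕ
    T        : Fin t → Fin t → Bool
    T-sym    : ∀ x y → T x y ≡ T y x
    T-irr    : ∀ x → T x x ≡ false
    connected : ∀ x y → Reach (Adj T) x y
    acyclic  : ¬ HasCycle T
    deg13    : ∀ x → degree T x ≡ 1 ⊎ degree T x ≡ 3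
    -- bijection between V(G) and the leaves of T
    leaf     : Fin (size G) → Fin t
    leaf-inj : Injective _≡_ _≡_ leaf
    leaf-onto : ∀ x → degree T x ≡ 1 → ∃ λ v → leaf v ≡ x
    leaf-deg : ∀ v → degree T (leaf v) ≡ 1

  side : Fin t → Fin t → Fin (size G) → Set
  side a b v = Reach (AdjMinus T a b) a (leaf v)

open RankDecomposition public

Width≤ : (G : Graph) → RankDecomposition G → ℕ → Set
Width≤ G D r = ∀ a b → T D a b ≡ true → CutRk≤ G (side D a b) r

-- rank-width of G is at most r  (graphs with ≤ 1 vertex have rank-width 0)
RankWidth≤ : Graph → ℕ → Set
RankWidth≤ G r = (size G ≤ 1) ⊎ Σ (RankDecomposition G) λ D → Width≤ G D r

GraphClass : Set₁
GraphClass = Graph → Set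

Hereditary : GraphClass → Set
Hereditary 𝒞 = ∀ (G : Graph) {m} (f : Fin m → Fin (size G)) →
  Injective _≡_ _≡_ f → 𝒞 G → 𝒞 (induced G f)

AdmitsLowRankWidthColorings : GraphClass → Set
AdmitsLowRankWidthColorings 𝒟 =
  Σ (ℕ → ℕ) λ N → Σ (ℕ → ℕ) λ Q →
  ∀ (p : ℕ) (G : Graph) → 𝒟 G →
  Σ (Fin (size G) → Fin (N p)) λ col →
    ∀ (i : ℕ) → i ≤ p → (I : Fin i → Fin (N p)) → Injective _≡_ _≡_ I →
    ∀ (m : ℕ) (f : Fin m → Fin (size G)) → Injective _≡_ _≡_ f →
    (∀ u → ∃ λ j → col (f u) ≡ I j) →
    (∀ v → (∃ λ j → col v ≡ I j) → ∃ λ u → f u ≡ v) →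
    RankWidth≤ (induced G f) (Q i)

-- Twisted chain graphs (0-based indices: (x,y) stands for the paper's
-- (x+1,y+1), so k = n·x + y + 1)

data Part (n : ℕ) : Set where
  vA : Fin n → Fin n → Part n
  wB : Fin n → Fin n → Part n
  zC : Fin n → Fin n → Part n

lt : ∀ {n} → Fin n → Fin n → Bool
lt a b = toℕ a <ᵇ toℕ b

le : ∀ {n} → Fin n → Fin n → Bool
le a b = toℕ a ≤ᵇ toℕ b

eq : ∀ {n} → Fin n → Fin n → Bool
eq a b = toℕ a ≡ᵇ toℕ b

IsTwistedChainGraph : (n : ℕ) → Graph → Set
IsTwistedChainGraph n G =
  Σ (Part n → Fin (size G)) λ φ →
    Injective _≡_ _≡_ φ × Surjective _≡_ _≡_ φ ×
    (∀ x y i j → E G (φ (vA x y)) (φ (zC i j)) ≡ (lt x i ∨ (eq x i ∧ le y j))) ×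
    (∀ x y i j → E G (φ (wB x y)) (φ (zC i j)) ≡ (lt x j ∨ (eq x j ∧ le y i)))

-- Suppose N, Q witness low rank-width colourings of 𝒞; fix the N 3 colours
-- and m > 6·(Q 0 + … + Q 3).  A twisted chain graph contains a *threshold
-- grid*: rows v_(x,1), columns w_(y,1), cells z_(i,j) with v_(x,1) ~ z_(i,j)
-- iff x ≤ i and w_(y,1) ~ z_(i,j) iff y ≤ j.  For large order, bipartite
-- Ramsey applied to the colour triples (z_(i,j), v_(i,1), w_(j,1)) yields a
-- threshold subgrid of order m whose cells, rows and columns are each
-- monochromatic; its ≤ 3 colour classes induce a subgraph of rank-width
-- ≤ Q i containing the grid.  Yet a threshold grid of order m has rank-width
-- > r when 6r < m: every rank-decomposition has an edge splitting the m²
-- cells in ratio at least 1:2, and such a cut contains an (r+1)×(r+1)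
-- triangular submatrix.
module Submission where

open import Defs hiding (sym)
open import Data.Nat using (ℕ; zero; suc; _+_; _*_; _^_; _≤_; _<_; z≤n; s≤s; _≤ᵇ_; _<ᵇ_; _≡ᵇ_; _≤?_; _<?_;
  NonZero; >-nonZero)
open import Data.Nat.Properties
open import Algebra.Properties.CommutativeSemigroup +-commutativeSemigroup using (interchange)
open import Data.Bool using (Bool; true; false; _∧_; _∨_; not)
open import Data.Bool.Properties using (T-≡; ¬-not; ∧-conicalˡ; ∧-conicalʳ; not-injective) renaming (_≟_ to _≟ᵇ_)
open import Data.Fin using (Fin; zero; suc; toℕ; fromℕ; fromℕ<; inject₁; inject≤; _↑ˡ_; _↑ʳ_; combine; remQuot;
  punchIn; punchOut) renaming (_≟_ to _≟ᶠ_)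
open import Data.Fin.Properties using (toℕ-injective; toℕ-inject≤; toℕ-↑ˡ; toℕ-↑ʳ; toℕ<n; toℕ-fromℕ<; any?;
  punchInᵢ≢i; punchIn-punchOut; remQuot-combine; combine-remQuot; combine-injective)
  renaming (suc-injective to fsuc-injective)
open import Data.List using (List; []; _∷_; length)
open import Data.List.Membership.Propositional using (_∈_)
open import Data.List.Relation.Unary.Any using (here; there)
import Data.List.Relation.Unary.Any as Any
open import Data.Product using (Σ; ∃; _×_; _,_; proj₁; proj₂)
open import Data.Sum using (_⊎_; inj₁; inj₂)
import Data.Sum as Sum
open import Data.Unit using (⊤; tt)
open import Data.Empty using (⊥; ⊥-elim)
open import Relation.Nullary using (¬_; yes; no)
open import Relation.Binary.Definitions using (tri<; tri≈; tri>)
open import Relation.Binary.PropositionalEquality using (_≡_; refl; sym; trans; cong; cong₂; subst; subst₂; _≢_;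
  module ≡-Reasoning)
open import Function.Bundles using (Equivalence)
open import Function.Definitions using (Injective)

-- Counting the true entries of a Boolean vector.  `count` is the
-- arithmetic-friendly twin of `countTrue` from Defs (which defines degrees).
indicator : Bool → ℕ
indicator true  = 1
indicator false = 0

count : ∀ {k} → (Fin k → Bool) → ℕ
count {zero}  f = 0
count {suc k} f = indicator (f zero) + count (λ i → f (suc i))

countTrue≡count : ∀ {k} (f : Fin k → Bool) → countTrue f ≡ count f
countTrue≡count {zero}  f = refl
countTrue≡count {suc k} f with f zero
... | true  = cong suc (countTrue≡count (λ i → f (suc i)))
... | false = countTrue≡count (λ i → f (suc i))

count-cong : ∀ {k} (f g : Fin k → Bool) → (∀ i → f i ≡ g i) → count f ≡ count g
count-cong {zero}  f g f≡g = refl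
count-cong {suc k} f g f≡g =
  cong₂ _+_ (cong indicator (f≡g zero)) (count-cong _ _ (λ i → f≡g (suc i)))

count≤ : ∀ {k} (f : Fin k → Bool) → count f ≤ k
count≤ {zero}  f = z≤n
count≤ {suc k} f with f zero
... | true  = s≤s (count≤ (λ i → f (suc i)))
... | false = m≤n⇒m≤1+n (count≤ (λ i → f (suc i)))

count-all : ∀ {k} (f : Fin k → Bool) → (∀ i → f i ≡ true) → count f ≡ k
count-all {zero}  f all = refl
count-all {suc k} f all rewrite all zero = cong suc (count-all _ (λ i → all (suc i)))

≤count-everything : ∀ k → k ≤ count {k} (λ _ → true)
≤count-everything k = ≤-reflexive (sym (count-all _ (λ _ → refl)))

count-none : ∀ {k} (f : Fin k → Bool) → (∀ i → f i ≡ false) → count f ≡ 0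
count-none {zero}  f none = refl
count-none {suc k} f none rewrite none zero = count-none _ (λ i → none (suc i))

indicator-mono : ∀ a b → (a ≡ true → b ≡ true) → indicator a ≤ indicator b
indicator-mono true  b a⇒b rewrite a⇒b refl = ≤-refl
indicator-mono false b a⇒b = z≤n

count-mono : ∀ {k} (f g : Fin k → Bool) → (∀ i → f i ≡ true → g i ≡ true) → count f ≤ count g
count-mono {zero}  f g f⇒g = z≤n
count-mono {suc k} f g f⇒g =
  +-mono-≤ (indicator-mono _ _ (f⇒g zero)) (count-mono _ _ (λ i → f⇒g (suc i)))

count-strict : ∀ {k} (f g : Fin k → Bool) → (∀ i → f i ≡ true → g i ≡ true) →
  (i : Fin k) → g i ≡ true → f i ≡ false → count f < count g
count-strict {suc k} f g f⇒g zero gi fi rewrite gi | fi =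
  s≤s (count-mono _ _ (λ i → f⇒g (suc i)))
count-strict {suc k} f g f⇒g (suc i) gi fi =
  +-mono-≤-< (indicator-mono _ _ (f⇒g zero)) (count-strict _ _ (λ i → f⇒g (suc i)) i gi fi)

indicator-split : ∀ a b → indicator a ≡ indicator (a ∧ b) + indicator (a ∧ not b)
indicator-split true  true  = refl
indicator-split true  false = refl
indicator-split false b     = refl

count-split : ∀ {k} (f g : Fin k → Bool) →
  count f ≡ count (λ i → f i ∧ g i) + count (λ i → f i ∧ not (g i))
count-split {zero}  f g = refl
count-split {suc k} f g
  rewrite indicator-split (f zero) (g zero) | count-split (λ i → f (suc i)) (λ i → g (suc i)) =
  interchange (indicator (f zero ∧ g zero)) (indicator (f zero ∧ not (g zero))) _ _

indicator-union : ∀ a b c → (a ≡ true → b ≡ true ⊎ c ≡ true) →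
  indicator a ≤ indicator b + indicator c
indicator-union false b c a⇒b∨c = z≤n
indicator-union true  b c a⇒b∨c with a⇒b∨c refl
... | inj₁ refl = s≤s z≤n
... | inj₂ refl = m≤n+m 1 (indicator b)

count-union : ∀ {k} (f g h : Fin k → Bool) → (∀ i → f i ≡ true → g i ≡ true ⊎ h i ≡ true) →
  count f ≤ count g + count h
count-union {zero}  f g h f⇒g∨h = z≤n
count-union {suc k} f g h f⇒g∨h = begin
  count f
    ≤⟨ +-mono-≤ (indicator-union _ _ _ (f⇒g∨h zero)) (count-union _ _ _ (λ i → f⇒g∨h (suc i))) ⟩
  (indicator (g zero) + indicator (h zero)) + (count g′ + count h′)
    ≡⟨ interchange (indicator (g zero)) (indicator (h zero)) (count g′) (count h′) ⟩
  count g + count h ∎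
  where
  open ≤-Reasoning
  g′ h′ : Fin k → Bool
  g′ i = g (suc i)
  h′ i = h (suc i)

count-atMostOne : ∀ {k} (f : Fin k → Bool) → (∀ i j → f i ≡ true → f j ≡ true → i ≡ j) → count f ≤ 1
count-atMostOne {zero}  f unique = z≤n
count-atMostOne {suc k} f unique with f zero in f0
... | true  = ≤-reflexive (cong suc (count-none _ rest-false))
  where
  rest-false : ∀ i → f (suc i) ≡ false
  rest-false i with f (suc i) in fi
  ... | false = refl
  ... | true with unique zero (suc i) f0 fi
  ...   | ()
... | false = count-atMostOne _ (λ i j fi fj → fsuc-injective (unique (suc i) (suc j) fi fj))

le⇒≤ : ∀ {n} {a b : Fin n} → le a b ≡ true → toℕ a ≤ toℕ b
le⇒≤ {a = a} {b} a≤ᵇb = ≤ᵇ⇒≤ (toℕ a) (toℕ b) (Equivalence.from T-≡ a≤ᵇb)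

≤⇒le : ∀ {n} {a b : Fin n} → toℕ a ≤ toℕ b → le a b ≡ true
≤⇒le a≤b = Equivalence.to T-≡ (≤⇒≤ᵇ a≤b)

>⇒le : ∀ {n} {a b : Fin n} → toℕ b < toℕ a → le a b ≡ false
>⇒le b<a = ¬-not (λ a≤ᵇb → <⇒≱ b<a (le⇒≤ a≤ᵇb))

false≢true : false ≢ true
false≢true ()

true⇔true : ∀ {a b} → (a ≡ true → b ≡ true) → (b ≡ true → a ≡ true) → a ≡ b
true⇔true {true}  {b}     a⇒b b⇒a = sym (a⇒b refl)
true⇔true {false} {true}  a⇒b b⇒a = b⇒a refl
true⇔true {false} {false} a⇒b b⇒a = refl

not≡true⇒≢true : ∀ {b} → not b ≡ true → b ≢ true
not≡true⇒≢true {false} _ ()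

Increasing : ∀ {m n} → (Fin m → Fin n) → Set
Increasing g = ∀ s s' → toℕ s < toℕ s' → toℕ (g s) < toℕ (g s')

module _ {m n} {g : Fin m → Fin n} (incr : Increasing g) where

  increasing-injective : Injective _≡_ _≡_ g
  increasing-injective {s} {s'} gs≡gs' with <-cmp (toℕ s) (toℕ s')
  ... | tri< s<s' _ _ = ⊥-elim (<-irrefl (cong toℕ gs≡gs') (incr s s' s<s'))
  ... | tri≈ _ s≡s' _ = toℕ-injective s≡s'
  ... | tri> _ _ s'<s = ⊥-elim (<-irrefl (cong toℕ (sym gs≡gs')) (incr s' s s'<s))

  increasing-mono : ∀ s s' → toℕ s ≤ toℕ s' → toℕ (g s) ≤ toℕ (g s')
  increasing-mono s s' s≤s' with m≤n⇒m<n∨m≡n s≤s'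
  ... | inj₁ s<s' = <⇒≤ (incr s s' s<s')
  ... | inj₂ s≡s' = ≤-reflexive (cong (λ x → toℕ (g x)) (toℕ-injective s≡s'))

  increasing-reflects : ∀ s s' → toℕ (g s) ≤ toℕ (g s') → toℕ s ≤ toℕ s'
  increasing-reflects s s' gs≤gs' with ≤-<-connex (toℕ s) (toℕ s')
  ... | inj₁ s≤s' = s≤s'
  ... | inj₂ s'<s = ⊥-elim (<⇒≱ (incr s' s s'<s) gs≤gs')

  increasing-le : ∀ s s' → le (g s) (g s') ≡ le s s'
  increasing-le s s' = true⇔true
    (λ gs≤gs' → ≤⇒le (increasing-reflects s s' (le⇒≤ gs≤gs')))
    (λ s≤s' → ≤⇒le (increasing-mono s s' (le⇒≤ s≤s')))

increasing-∘ : ∀ {k m n} {f : Fin m → Fin n} {g : Fin k → Fin m} →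
  Increasing f → Increasing g → Increasing (λ s → f (g s))
increasing-∘ {f = f} {g} f↑ g↑ s s' s<s' = f↑ (g s) (g s') (g↑ s s' s<s')

↑ˡ-increasing : ∀ {m} n → Increasing (λ (i : Fin m) → i ↑ˡ n)
↑ˡ-increasing n s s' s<s' rewrite toℕ-↑ˡ s n | toℕ-↑ˡ s' n = s<s'

↑ʳ-increasing : ∀ m {n} → Increasing (λ (j : Fin n) → m ↑ʳ j)
↑ʳ-increasing m s s' s<s' rewrite toℕ-↑ʳ m s | toℕ-↑ʳ m s' = +-monoʳ-< m s<s'

record Enumeration {k : ℕ} (f : Fin k → Bool) (q : ℕ) : Set where
  field
    at         : Fin q → Fin k
    increasing : Increasing at
    member     : ∀ s → f (at s) ≡ true
    onto       : ∀ i → f i ≡ true → ∃ λ s → at s ≡ i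

enumerate : ∀ {k} (f : Fin k → Bool) → Enumeration f (count f)
enumerate {zero}  f = record { at = λ () ; increasing = λ () ; member = λ () ; onto = λ () }
enumerate {suc k} f with f zero in f0
... | true = record { at = at′ ; increasing = increasing′ ; member = member′ ; onto = onto′ }
  where
  open Enumeration (enumerate (λ i → f (suc i)))
  at′ : Fin (suc (count (λ i → f (suc i)))) → Fin (suc k)
  at′ zero    = zero
  at′ (suc s) = suc (at s)
  increasing′ : Increasing at′
  increasing′ zero    (suc s') _         = s≤s z≤n
  increasing′ (suc s) (suc s') (s≤s s<s') = s≤s (increasing s s' s<s')
  member′ : ∀ s → f (at′ s) ≡ true
  member′ zero    = f0
  member′ (suc s) = member s
  onto′ : ∀ i → f i ≡ true → ∃ λ s → at′ s ≡ i
  onto′ zero    _  = zero , refl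
  onto′ (suc i) fi with onto i fi
  ... | s , ats≡i = suc s , cong suc ats≡i
... | false = record
  { at = λ s → suc (at s) ; increasing = λ s s' s<s' → s≤s (increasing s s' s<s')
  ; member = member ; onto = onto′ }
  where
  open Enumeration (enumerate (λ i → f (suc i)))
  onto′ : ∀ i → f i ≡ true → ∃ λ s → suc (at s) ≡ i
  onto′ zero    f0≡true = ⊥-elim (false≢true (trans (sym f0) f0≡true))
  onto′ (suc i) fi with onto i fi
  ... | s , ats≡i = s , cong suc ats≡i

select : ∀ {k} (f : Fin k → Bool) (q : ℕ) → q ≤ count f →
  Σ (Fin q → Fin k) λ g → Increasing g × (∀ s → f (g s) ≡ true)
select f q q≤ = (λ s → at (inject≤ s q≤)) , increasing′ , (λ s → member (inject≤ s q≤))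
  where
  open Enumeration (enumerate f)
  increasing′ : Increasing (λ s → at (inject≤ s q≤))
  increasing′ s s' s<s' = increasing _ _
    (subst₂ _<_ (sym (toℕ-inject≤ s q≤)) (sym (toℕ-inject≤ s' q≤)) s<s')

parity-none : ∀ {k} (f : Fin k → Bool) → (∀ i → f i ≡ false) → parity f ≡ false
parity-none {zero}  f none = refl
parity-none {suc k} f none rewrite none zero = parity-none _ (λ i → none (suc i))

parity-single : ∀ {k} (f : Fin k → Bool) (s : Fin k) → f s ≡ true →
  (∀ i → i ≢ s → f i ≡ false) → parity f ≡ true
parity-single {suc k} f zero fs others rewrite fs =
  cong not (parity-none _ (λ i → others (suc i) (λ ())))
parity-single {suc k} f (suc s) fs others rewrite others zero (λ ()) =
  parity-single (λ i → f (suc i)) s fs (λ i i≢s → others (suc i) (λ si≡ss → i≢s (fsuc-injective si≡ss)))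

firstTrue : ∀ {k} (c : Fin k → Bool) (i : Fin k) → c i ≡ true →
  Σ (Fin k) λ s → c s ≡ true × (∀ j → c j ≡ true → toℕ s ≤ toℕ j)
firstTrue {suc k} c i ci with c zero in c0
... | true = zero , c0 , (λ _ _ → z≤n)
firstTrue {suc k} c zero ci | false with trans (sym c0) ci
... | ()
firstTrue {suc k} c (suc i) ci | false with firstTrue (λ j → c (suc j)) i ci
... | s , cs , first = suc s , cs , first′
  where
  first′ : ∀ j → c j ≡ true → toℕ (suc s) ≤ toℕ j
  first′ zero    cj with trans (sym c0) cj
  ... | ()
  first′ (suc j) cj = s≤s (first j cj)

lastTrue : ∀ {k} (c : Fin k → Bool) (i : Fin k) → c i ≡ true →
  Σ (Fin k) λ s → c s ≡ true × (∀ j → c j ≡ true → toℕ j ≤ toℕ s)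
lastTrue {suc k} c i ci with any? (λ j → c (suc j) ≟ᵇ true)
... | yes (j , cj) with lastTrue (λ j → c (suc j)) j cj
...   | s , cs , last = suc s , cs , last′
  where
  last′ : ∀ j → c j ≡ true → toℕ j ≤ toℕ (suc s)
  last′ zero    _  = z≤n
  last′ (suc j) cj = s≤s (last j cj)
lastTrue {suc k} c zero    ci | no none = zero , ci , last′
  where
  last′ : ∀ j → c j ≡ true → toℕ j ≤ 0
  last′ zero    _  = z≤n
  last′ (suc j) cj = ⊥-elim (none (j , cj))
lastTrue {suc k} c (suc i) ci | no none = ⊥-elim (none (i , ci))

-- Separated rows are independent over GF(2), so
-- r+1 separated rows in X force cutrk(X) > r.
Separated : (H : Graph) (X : Fin (size H) → Set) {k : ℕ} → (Fin k → Fin (size H)) → Set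
Separated H X {k} ρ = ∀ (c : Fin k → Bool) (i : Fin k) → c i ≡ true →
  Σ (Fin (size H)) λ v → ¬ X v × Σ (Fin k) λ s → c s ≡ true × E H (ρ s) v ≡ true ×
    (∀ j → j ≢ s → c j ≡ true → E H (ρ j) v ≡ false)

independentRows : (H : Graph) (X : Fin (size H) → Set) (r : ℕ) (ρ : Fin (suc r) → Fin (size H)) →
  Injective _≡_ _≡_ ρ → (∀ s → X (ρ s)) → Separated H X ρ → ¬ CutRk≤ H X r
independentRows H X r ρ ρ-inj ρ∈X separated rank≤r with rank≤r ρ ρ-inj ρ∈X
... | c , (i , ci) , even with separated c i ci
...   | v , v∉X , s , cs , ρs~v , others = false≢true (trans (sym (even v v∉X)) odd)
  where
  others′ : ∀ j → j ≢ s → (c j ∧ E H (ρ j) v) ≡ false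
  others′ j j≢s with c j in cj
  ... | false = refl
  ... | true  = others j j≢s cj
  odd : parity (λ j → c j ∧ E H (ρ j) v) ≡ true
  odd = parity-single _ s (cong₂ _∧_ cs ρs~v) others′

-- An upper (resp. lower) triangular (r+1)×(r+1) submatrix with rows in X and
-- columns outside X forces cutrk(X) > r: the first (resp. last) selected row
-- is the only selected one meeting its diagonal column.
upperTriangular : (H : Graph) (X : Fin (size H) → Set) (r : ℕ) (ρ κ : Fin (suc r) → Fin (size H)) →
  Injective _≡_ _≡_ ρ → (∀ s → X (ρ s)) → (∀ q → ¬ X (κ q)) →
  (∀ s q → E H (ρ s) (κ q) ≡ le s q) → ¬ CutRk≤ H X r
upperTriangular H X r ρ κ ρ-inj ρ∈X κ∉X ρκ≡le = independentRows H X r ρ ρ-inj ρ∈X separated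
  where
  separated : Separated H X ρ
  separated c i ci with firstTrue c i ci
  ... | s , cs , first = κ s , κ∉X s , s , cs , trans (ρκ≡le s s) (≤⇒le {a = s} {s} ≤-refl) , others
    where
    others : ∀ j → j ≢ s → c j ≡ true → E H (ρ j) (κ s) ≡ false
    others j j≢s cj = trans (ρκ≡le j s)
      (>⇒le (≤∧≢⇒< (first j cj) (λ s≡j → j≢s (toℕ-injective (sym s≡j)))))

lowerTriangular : (H : Graph) (X : Fin (size H) → Set) (r : ℕ) (ρ κ : Fin (suc r) → Fin (size H)) →
  Injective _≡_ _≡_ ρ → (∀ s → X (ρ s)) → (∀ q → ¬ X (κ q)) →
  (∀ s q → E H (ρ s) (κ q) ≡ le q s) → ¬ CutRk≤ H X r
lowerTriangular H X r ρ κ ρ-inj ρ∈X κ∉X ρκ≡le = independentRows H X r ρ ρ-inj ρ∈X separated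
  where
  separated : Separated H X ρ
  separated c i ci with lastTrue c i ci
  ... | s , cs , last = κ s , κ∉X s , s , cs , trans (ρκ≡le s s) (≤⇒le {a = s} {s} ≤-refl) , others
    where
    others : ∀ j → j ≢ s → c j ≡ true → E H (ρ j) (κ s) ≡ false
    others j j≢s cj = trans (ρκ≡le j s)
      (>⇒le (≤∧≢⇒< (last j cj) (λ j≡s → j≢s (toℕ-injective j≡s))))

-- Either the top colour
-- K occurs q times, or the other entries are at least K * q and induction applies.
sameColour : ∀ {k} → (Fin k → ℕ) → ℕ → Fin k → Bool
sameColour g κ i = g i ≡ᵇ κ

sameColour⇒≡ : ∀ {k} (g : Fin k → ℕ) κ i → sameColour g κ i ≡ true → g i ≡ κ
sameColour⇒≡ g κ i same = ≡ᵇ⇒≡ (g i) κ (Equivalence.from T-≡ same)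

pigeonhole : ∀ {k} K q (S : Fin k → Bool) (g : Fin k → ℕ) → (∀ i → S i ≡ true → g i < suc K) →
  suc K * q ≤ count S → Σ ℕ λ κ → κ < suc K × q ≤ count (λ i → S i ∧ sameColour g κ i)
pigeonhole zero q S g g<1 q≤ = 0 , s≤s z≤n ,
  subst (_≤ _) (*-identityˡ q) (≤-trans q≤ (≤-reflexive (count-cong _ _ onlyColour)))
  where
  onlyColour : ∀ i → S i ≡ (S i ∧ sameColour g 0 i)
  onlyColour i with S i in Si
  ... | false = refl
  ... | true with g i | g<1 i Si
  ...   | zero  | _         = refl
  ...   | suc _ | s≤s ()
pigeonhole {k} (suc K) q S g g<2+K q≤ with q ≤? count (λ i → S i ∧ sameColour g (suc K) i)
... | yes enough = suc K , ≤-refl , enough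
... | no few with pigeonhole K q S′ g g<1+K fewer
  where
  S′ : Fin k → Bool
  S′ i = S i ∧ not (sameColour g (suc K) i)
  g<1+K : ∀ i → S′ i ≡ true → g i < suc K
  g<1+K i S′i = ≤∧≢⇒< (≤-pred (g<2+K i (∧-conicalˡ _ _ S′i)))
    (λ gi≡1+K → not≡true⇒≢true (∧-conicalʳ _ _ S′i) (Equivalence.to T-≡ (≡⇒≡ᵇ (g i) (suc K) gi≡1+K)))
  fewer : suc K * q ≤ count S′
  fewer = +-cancelˡ-≤ q _ _ (begin
    q + suc K * q                                                 ≤⟨ q≤ ⟩
    count S                                                       ≡⟨ count-split S (sameColour g (suc K)) ⟩
    count (λ i → S i ∧ sameColour g (suc K) i) + count S′         ≤⟨ +-monoˡ-≤ (count S′) (<⇒≤ (≰⇒> few)) ⟩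
    q + count S′                                                  ∎)
    where open ≤-Reasoning
...   | κ , κ<1+K , q≤κ = κ , m<n⇒m<1+n κ<1+K , ≤-trans q≤κ (count-mono _ _ dropLast)
  where
  dropLast : ∀ i → ((S i ∧ not (sameColour g (suc K) i)) ∧ sameColour g κ i) ≡ true →
             (S i ∧ sameColour g κ i) ≡ true
  dropLast i both with S i
  ... | true  = ∧-conicalʳ _ _ both
  ... | false = both

hasColour : ∀ {k n} → (Fin k → Fin n) → Fin n → Fin k → Bool
hasColour g κ i = toℕ (g i) ≡ᵇ toℕ κ

hasColour⇒≡ : ∀ {k n} (g : Fin k → Fin n) κ i → hasColour g κ i ≡ true → g i ≡ κ
hasColour⇒≡ g κ i same = toℕ-injective (sameColour⇒≡ (λ i → toℕ (g i)) (toℕ κ) i same)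

≡⇒hasColour : ∀ {k n} (g : Fin k → Fin n) κ i → g i ≡ κ → hasColour g κ i ≡ true
≡⇒hasColour g κ i gi≡κ = Equivalence.to T-≡ (≡⇒≡ᵇ (toℕ (g i)) (toℕ κ) (cong toℕ gi≡κ))

pigeonholeFin : ∀ {k} K q (S : Fin k → Bool) (g : Fin k → Fin (suc K)) → suc K * q ≤ count S →
  Σ (Fin (suc K)) λ κ → q ≤ count (λ i → S i ∧ hasColour g κ i)
pigeonholeFin K q S g q≤ with pigeonhole K q S (λ i → toℕ (g i)) (λ i _ → toℕ<n (g i)) q≤
... | κ , κ<1+K , q≤κ = fromℕ< κ<1+K , subst (λ κ′ → q ≤ count (λ i → S i ∧ (toℕ (g i) ≡ᵇ κ′)))
                                             (sym (toℕ-fromℕ< κ<1+K)) q≤κ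

constantColumns : ∀ {n} K k (c : Fin k → Fin n → Fin (suc K)) q (S₀ : Fin n → Bool) →
  suc K ^ k * q ≤ count S₀ →
  Σ (Fin n → Bool) λ S → Σ (Fin k → Fin (suc K)) λ κ →
    q ≤ count S × (∀ j → S j ≡ true → S₀ j ≡ true) × (∀ t j → S j ≡ true → c t j ≡ κ t)
constantColumns K zero    c q S₀ q≤ = S₀ , (λ ()) , subst (_≤ count S₀) (*-identityˡ q) q≤ , (λ _ S₀j → S₀j) , (λ ())
constantColumns K (suc k) c q S₀ q≤
  with pigeonholeFin K (suc K ^ k * q) S₀ (c zero) (subst (_≤ count S₀) (*-assoc (suc K) (suc K ^ k) q) q≤)
... | κ₀ , q≤κ₀ with constantColumns K k (λ t → c (suc t)) q (λ j → S₀ j ∧ hasColour (c zero) κ₀ j) q≤κ₀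
...   | S , κ , q≤S , S⊆ , constant = S , κ′ , q≤S , (λ j Sj → ∧-conicalˡ _ _ (S⊆ j Sj)) , constant′
  where
  κ′ : Fin (suc k) → Fin (suc K)
  κ′ zero    = κ₀
  κ′ (suc t) = κ t
  constant′ : ∀ t j → S j ≡ true → c t j ≡ κ′ t
  constant′ zero    j Sj = hasColour⇒≡ (c zero) κ₀ j (∧-conicalʳ _ _ (S⊆ j Sj))
  constant′ (suc t) j Sj = constant t j Sj

record MonochromaticSubgrid {R C K : ℕ} (c : Fin R → Fin C → Fin K) (m : ℕ) : Set where
  field
    rows            : Fin m → Fin R
    cols            : Fin m → Fin C
    rows-increasing : Increasing rows
    cols-increasing : Increasing cols
    commonColour    : Fin K
    monochromatic   : ∀ s u → c (rows s) (cols u) ≡ commonColour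

-- First make every row
-- constant on m common columns, then pick m rows whose constants agree.
bipartiteRamsey : ∀ K m .⦃ _ : NonZero K ⦄ (c : Fin (K * m) → Fin (K ^ (K * m) * m) → Fin K) →
  MonochromaticSubgrid c m
bipartiteRamsey (suc K) m c with constantColumns K (suc K * m) c m (λ _ → true) (≤count-everything _)
... | S , κ , m≤S , _ , rowConstant with pigeonholeFin K m (λ _ → true) κ (≤count-everything _)
...   | κ* , m≤κ* with select _ m m≤κ* | select S m m≤S
...     | g , g↑ , κg≡κ* | h , h↑ , Sh = record
  { rows = g ; cols = h ; rows-increasing = g↑ ; cols-increasing = h↑ ; commonColour = κ*
  ; monochromatic = λ s u → trans (rowConstant (g s) (h u) (Sh u))
                                  (hasColour⇒≡ κ κ* (g s) (κg≡κ* s)) }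

module _ {t : ℕ} {R : Fin t → Fin t → Set} where

  visited : {x y : Fin t} → Reach R x y → List (Fin t)
  visited {x = x} here       = x ∷ []
  visited {x = x} (step r w) = x ∷ visited w

  Simple : {x y : Fin t} → Reach R x y → Set
  Simple here                = ⊤
  Simple {x = x} (step r w)  = ¬ (x ∈ visited w) × Simple w

  start-visited : {x y : Fin t} (w : Reach R x y) → x ∈ visited w
  start-visited here       = here refl
  start-visited (step r w) = here refl

  suffixFrom : {x y z : Fin t} (w : Reach R y z) → x ∈ visited w → Simple w →
    Σ (Reach R x z) Simple
  suffixFrom here       (here refl) simple = here , tt
  suffixFrom (step r w) (here refl) simple = step r w , simple
  suffixFrom (step r w) (there x∈w) (_ , simple) = suffixFrom w x∈w simple

  prefixTo : {x y b : Fin t} (w : Reach R x y) → b ∈ visited w → Reach R x b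
  prefixTo here       (here refl) = here
  prefixTo (step r w) (here refl) = here
  prefixTo (step r w) (there b∈w) = step r (prefixTo w b∈w)

  simplify : {x y : Fin t} (w : Reach R x y) → Σ (Reach R x y) Simple
  simplify here = here , tt
  simplify {x = x} (step r w) with simplify w
  ... | w′ , simple with Any.any? (x ≟ᶠ_) (visited w′)
  ...   | yes x∈w′ = suffixFrom w′ x∈w′ simple
  ...   | no  x∉w′ = step r w′ , x∉w′ , simple

  _++ʷ_ : {x y z : Fin t} → Reach R x y → Reach R y z → Reach R x z
  here       ++ʷ w′ = w′
  step r w   ++ʷ w′ = step r (w ++ʷ w′)

  mapʷ : {R′ : Fin t → Fin t → Set} → (∀ x y → R x y → R′ x y) → {x y : Fin t} → Reach R x y → Reach R′ x y
  mapʷ f here                = here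
  mapʷ f (step {x} {y} r w)  = step (f x y r) (mapʷ f w)

  reverseʷ : (∀ x y → R x y → R y x) → {x y : Fin t} → Reach R x y → Reach R y x
  reverseʷ R-sym here               = here
  reverseʷ R-sym (step {x} {y} r w) = reverseʷ R-sym w ++ʷ step (R-sym x y r) here

  steps : {x y : Fin t} → Reach R x y → ℕ
  steps here       = 0
  steps (step r w) = suc (steps w)

  vertexAt : {x y : Fin t} (w : Reach R x y) → Fin (suc (steps w)) → Fin t
  vertexAt {x = x} here       zero    = x
  vertexAt {x = x} (step r w) zero    = x
  vertexAt         (step r w) (suc i) = vertexAt w i

  vertexAt-first : {x y : Fin t} (w : Reach R x y) → vertexAt w zero ≡ x
  vertexAt-first here       = refl
  vertexAt-first (step r w) = refl

  vertexAt-last : {x y : Fin t} (w : Reach R x y) → vertexAt w (fromℕ (steps w)) ≡ y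
  vertexAt-last here       = refl
  vertexAt-last (step r w) = vertexAt-last w

  vertexAt-step : {x y : Fin t} (w : Reach R x y) (i : Fin (steps w)) →
    R (vertexAt w (inject₁ i)) (vertexAt w (suc i))
  vertexAt-step (step {x} r w) zero    = subst (R x) (sym (vertexAt-first w)) r
  vertexAt-step (step r w)     (suc i) = vertexAt-step w i

  vertexAt-visited : {x y : Fin t} (w : Reach R x y) (i : Fin (suc (steps w))) →
    vertexAt w i ∈ visited w
  vertexAt-visited here       zero    = here refl
  vertexAt-visited (step r w) zero    = here refl
  vertexAt-visited (step r w) (suc i) = there (vertexAt-visited w i)

  vertexAt-injective : {x y : Fin t} (w : Reach R x y) → Simple w →
    ∀ {i j} → vertexAt w i ≡ vertexAt w j → i ≡ j
  vertexAt-injective here       _            {zero}  {zero}  _ = refl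
  vertexAt-injective (step r w) _            {zero}  {zero}  _ = refl
  vertexAt-injective (step r w) (x∉w , _)    {zero}  {suc j} x≡ =
    ⊥-elim (x∉w (subst (_∈ visited w) (sym x≡) (vertexAt-visited w j)))
  vertexAt-injective (step r w) (x∉w , _)    {suc i} {zero}  ≡x =
    ⊥-elim (x∉w (subst (_∈ visited w) ≡x (vertexAt-visited w i)))
  vertexAt-injective (step r w) (_ , simple) {suc i} {suc j} ≡  = cong suc (vertexAt-injective w simple ≡)

adjMinus-sym : ∀ {t} (T : Fin t → Fin t → Bool) → (∀ x y → T x y ≡ T y x) →
  ∀ a b x y → AdjMinus T a b x y → AdjMinus T a b y x
adjMinus-sym T T-sym a b x y (Txy , not-ab) = trans (T-sym y x) Txy ,
  λ { (inj₁ (y≡a , x≡b)) → not-ab (inj₂ (x≡b , y≡a)) ; (inj₂ (y≡b , x≡a)) → not-ab (inj₁ (x≡a , y≡b)) }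

adjMinus-swap : ∀ {t} (T : Fin t → Fin t → Bool) → ∀ a b x y → AdjMinus T a b x y → AdjMinus T b a x y
adjMinus-swap T a b x y (Txy , not-ab) = Txy ,
  λ { (inj₁ (x≡b , y≡a)) → not-ab (inj₂ (x≡b , y≡a)) ; (inj₂ (x≡a , y≡b)) → not-ab (inj₁ (x≡a , y≡b)) }

module TreeSides {t : ℕ} (T : Fin t → Fin t → Bool) (T-sym : ∀ x y → T x y ≡ T y x)
  (T-irr : ∀ x → T x x ≡ false) (connected : ∀ x y → Reach (Adj T) x y) (acyclic : ¬ HasCycle T) where

  Side : Fin t → Fin t → Fin t → Set
  Side a b x = Reach (AdjMinus T a b) a x

  edge-≢ : ∀ {a b} → T a b ≡ true → a ≢ b
  edge-≢ {a} Tab refl with trans (sym (T-irr a)) Tab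
  ... | ()

  avoiding : {R : Fin t → Fin t → Set} {u v : Fin t} (w : Reach R u v) → (∀ x y → R x y → T x y ≡ true) →
    ∀ {p} q → ¬ (p ∈ visited w) → Reach (AdjMinus T p q) u v
  avoiding here       R⊆T q p∉w = here
  avoiding (step {x} {y} r w) R⊆T {p} q p∉w =
    step (R⊆T x y r , not-pq) (avoiding w R⊆T q (λ p∈w → p∉w (there p∈w)))
    where
    not-pq : ¬ ((x ≡ p × y ≡ q) ⊎ (x ≡ q × y ≡ p))
    not-pq (inj₁ (refl , _)) = p∉w (here refl)
    not-pq (inj₂ (_ , refl)) = p∉w (there (start-visited w))

  -- every tree edge is a bridge: a walk around it would close a cycle
  bridge : ∀ {a b} → T a b ≡ true → ¬ Reach (AdjMinus T a b) a b
  bridge {a} {b} Tab w with simplify w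
  ... | here , _ = edge-≢ Tab refl
  ... | step r here , _ = proj₂ r (inj₁ (refl , refl))
  ... | w′@(step _ (step _ w″)) , simple =
    acyclic (steps w″ , vertexAt w′ , vertexAt-injective w′ simple , (λ i → proj₁ (vertexAt-step w′ i)) ,
             trans (cong₂ T (vertexAt-last w′) refl) (trans (T-sym b a) Tab))

  -- a walk from a to x and one from b to x would combine to a detour around ab
  sides-disjoint : ∀ {a b x} → T a b ≡ true → Side a b x → Side b a x → ⊥
  sides-disjoint {a} {b} Tab a⇝x b⇝x =
    bridge Tab (a⇝x ++ʷ reverseʷ (adjMinus-sym T T-sym a b) (mapʷ (adjMinus-swap T b a) b⇝x))

  -- a simple walk from a to x either starts with the edge ab or avoids it
  sides-cover : ∀ {a b} → T a b ≡ true → ∀ x → Side a b x ⊎ Side b a x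
  sides-cover {a} {b} Tab x with simplify (connected a x)
  ... | here , _ = inj₁ here
  ... | step {y = y} r w , a∉w , _ with y ≟ᶠ b
  ...   | yes refl = inj₂ (mapʷ (adjMinus-swap T a b) (avoiding w (λ _ _ Txy → Txy) b a∉w))
  ...   | no  y≢b  = inj₁ (step (r , not-ab) (avoiding w (λ _ _ Txy → Txy) b a∉w))
    where
    not-ab : ¬ ((a ≡ a × y ≡ b) ⊎ (a ≡ b × y ≡ a))
    not-ab (inj₁ (_ , y≡b)) = y≢b y≡b
    not-ab (inj₂ (a≡b , _)) = edge-≢ Tab a≡b

  -- a simple walk from c to x avoiding cb cannot pass b, so it extends by ab
  side-nested : ∀ {a b c x} → T b c ≡ true → T b a ≡ true → c ≢ a → Side c b x → Side b a x
  side-nested {a} {b} {c} Tbc Tba c≢a c⇝x with simplify c⇝x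
  ... | w , _ with Any.any? (b ≟ᶠ_) (visited w)
  ...   | yes b∈w = ⊥-elim (bridge (trans (T-sym c b) Tbc) (prefixTo w b∈w))
  ...   | no  b∉w = step (Tbc , not-ba) (avoiding w (λ _ _ → proj₁) a b∉w)
    where
    not-ba : ¬ ((b ≡ b × c ≡ a) ⊎ (b ≡ a × c ≡ b))
    not-ba (inj₁ (_ , c≡a)) = c≢a c≡a
    not-ba (inj₂ (b≡a , _)) = edge-≢ Tba b≡a

  -- a simple walk from b to x ≠ b avoiding ba starts with bc or bd
  side-split : ∀ {a b c d x} → (∀ y → T b y ≡ true → y ≡ a ⊎ y ≡ c ⊎ y ≡ d) → x ≢ b →
    Side b a x → Side c b x ⊎ Side d b x
  side-split {a} {b} {c} {d} neighbours x≢b b⇝x with simplify b⇝x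
  ... | here , _ = ⊥-elim (x≢b refl)
  ... | step {y = y} r w , b∉w , _ with neighbours y (proj₁ r)
  ...   | inj₁ refl        = ⊥-elim (proj₂ r (inj₁ (refl , refl)))
  ...   | inj₂ (inj₁ refl) = inj₁ (mapʷ (adjMinus-swap T b c) (avoiding w (λ _ _ → proj₁) c b∉w))
  ...   | inj₂ (inj₂ refl) = inj₂ (mapʷ (adjMinus-swap T b d) (avoiding w (λ _ _ → proj₁) d b∉w))

  onSide : ∀ {a b} → T a b ≡ true → Fin t → Bool
  onSide Tab x with sides-cover Tab x
  ... | inj₁ _ = true
  ... | inj₂ _ = false

  onSide⇒Side : ∀ {a b} (Tab : T a b ≡ true) x → onSide Tab x ≡ true → Side a b x
  onSide⇒Side Tab x on with sides-cover Tab x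
  onSide⇒Side Tab x on  | inj₁ a⇝x = a⇝x
  onSide⇒Side Tab x () | inj₂ _

  Side⇒onSide : ∀ {a b} (Tab : T a b ≡ true) x → Side a b x → onSide Tab x ≡ true
  Side⇒onSide Tab x a⇝x with sides-cover Tab x
  ... | inj₁ _   = refl
  ... | inj₂ b⇝x = ⊥-elim (sides-disjoint Tab a⇝x b⇝x)

  otherSide⇒¬onSide : ∀ {a b} (Tab : T a b ≡ true) x → Side b a x → onSide Tab x ≡ false
  otherSide⇒¬onSide Tab x b⇝x with sides-cover Tab x
  ... | inj₁ a⇝x = ⊥-elim (sides-disjoint Tab a⇝x b⇝x)
  ... | inj₂ _   = refl

  onSide-flip : ∀ {a b} (Tab : T a b ≡ true) (Tba : T b a ≡ true) x → onSide Tba x ≡ not (onSide Tab x)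
  onSide-flip Tab Tba x with sides-cover Tab x
  ... | inj₁ a⇝x = otherSide⇒¬onSide Tba x a⇝x
  ... | inj₂ b⇝x = Side⇒onSide Tba x b⇝x

data Balance (M x y : ℕ) : Set where
  farHeavy : 2 * M < 3 * y → Balance M x y
  balanced : M ≤ 3 * x → M ≤ 3 * y → Balance M x y
  farLight : 3 * y < M → Balance M x y

balance : ∀ x y M → x + y ≡ M → Balance M x y
balance x y M x+y≡M with 2 * M <? 3 * y | M ≤? 3 * y
... | yes heavy   | _         = farHeavy heavy
... | no _        | no light  = farLight (≰⇒> light)
... | no notHeavy | yes M≤3y  = balanced M≤3x M≤3y
  where
  M≤3x : M ≤ 3 * x
  M≤3x = +-cancelʳ-≤ (2 * M) M (3 * x) (begin
    3 * M          ≡⟨ cong (3 *_) (sym x+y≡M) ⟩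
    3 * (x + y)    ≡⟨ *-distribˡ-+ 3 x y ⟩
    3 * x + 3 * y  ≤⟨ +-monoʳ-≤ (3 * x) (≮⇒≥ notHeavy) ⟩
    3 * x + 2 * M  ∎)
    where open ≤-Reasoning

farLight⇒nearHeavy : ∀ x y M → x + y ≡ M → 3 * y < M → 2 * M < 3 * x
farLight⇒nearHeavy x y M x+y≡M light = +-cancelʳ-< M (2 * M) (3 * x) (begin-strict
  2 * M + M      ≡⟨ +-comm (2 * M) M ⟩
  3 * M          ≡⟨ cong (3 *_) (sym x+y≡M) ⟩
  3 * (x + y)    ≡⟨ *-distribˡ-+ 3 x y ⟩
  3 * x + 3 * y  <⟨ +-monoʳ-< (3 * x) light ⟩
  3 * x + M      ∎)
  where open ≤-Reasoning

-- Walk along edges a→b whose b-side carries more than 2M/3 leaves: at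
-- a degree-3 vertex b with further neighbours c, d either some edge bc, bd is
-- balanced, or the walk continues into the heavy side (which has fewer
-- vertices), or both c- and d-side are light, contradicting heaviness.
module BalancedEdge {t : ℕ} (T : Fin t → Fin t → Bool) (T-sym : ∀ x y → T x y ≡ T y x)
  (T-irr : ∀ x → T x x ≡ false) (connected : ∀ x y → Reach (Adj T) x y) (acyclic : ¬ HasCycle T)
  (deg13 : ∀ x → degree T x ≡ 1 ⊎ degree T x ≡ 3)
  {M : ℕ} (2≤M : 2 ≤ M) (L : Fin M → Fin t) (L-inj : ∀ {k k'} → L k ≡ L k' → k ≡ k')
  (L-leaf : ∀ k → degree T (L k) ≡ 1) where

  open TreeSides T T-sym T-irr connected acyclic

  neighbourhood : ∀ x q → degree T x ≡ q → Enumeration (T x) q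
  neighbourhood x q deg≡q =
    subst (Enumeration (T x)) (trans (sym (countTrue≡count (T x))) deg≡q) (enumerate (T x))

  uniqueNeighbour : ∀ x → degree T x ≡ 1 → Σ (Fin t) λ b → T x b ≡ true × (∀ y → T x y ≡ true → y ≡ b)
  uniqueNeighbour x deg≡1 = at zero , member zero , unique
    where
    open Enumeration (neighbourhood x 1 deg≡1)
    unique : ∀ y → T x y ≡ true → y ≡ at zero
    unique y Txy with onto y Txy
    ... | zero , at0≡y = sym at0≡y

  record OtherNeighbours (b a : Fin t) : Set where
    field
      c d        : Fin t
      Tbc        : T b c ≡ true
      Tbd        : T b d ≡ true
      c≢a        : c ≢ a
      d≢a        : d ≢ a
      neighbours : ∀ y → T b y ≡ true → y ≡ a ⊎ y ≡ c ⊎ y ≡ d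

  otherNeighbours : ∀ b a → degree T b ≡ 3 → T b a ≡ true → OtherNeighbours b a
  otherNeighbours b a deg≡3 Tba = fromPosition (onto a Tba)
    where
    open Enumeration (neighbourhood b 3 deg≡3)
    fromPosition : (∃ λ s₀ → at s₀ ≡ a) → OtherNeighbours b a
    fromPosition (s₀ , at-s₀≡a) = record
      { c = at (punchIn s₀ zero) ; d = at (punchIn s₀ (suc zero))
      ; Tbc = member _ ; Tbd = member _
      ; c≢a = λ c≡a → punchInᵢ≢i s₀ zero (increasing-injective increasing (trans c≡a (sym at-s₀≡a)))
      ; d≢a = λ d≡a → punchInᵢ≢i s₀ (suc zero) (increasing-injective increasing (trans d≡a (sym at-s₀≡a)))
      ; neighbours = neighbours }
      where
      neighbours : ∀ y → T b y ≡ true → y ≡ a ⊎ y ≡ at (punchIn s₀ zero) ⊎ y ≡ at (punchIn s₀ (suc zero))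
      neighbours y Tby with onto y Tby
      ... | s , refl with s₀ ≟ᶠ s
      ...   | yes refl = inj₁ at-s₀≡a
      ...   | no s₀≢s with punchOut s₀≢s | punchIn-punchOut s₀≢s
      ...     | zero     | eq = inj₂ (inj₁ (cong at (sym eq)))
      ...     | suc zero | eq = inj₂ (inj₂ (cong at (sym eq)))

  reverseEdge : ∀ {a b} → T a b ≡ true → T b a ≡ true
  reverseEdge {a} {b} Tab = trans (T-sym b a) Tab

  leavesOn : ∀ {a b} → T a b ≡ true → ℕ
  leavesOn Tab = count (λ k → onSide Tab (L k))

  leavesOn-sum : ∀ {a b} (Tab : T a b ≡ true) → leavesOn Tab + leavesOn (reverseEdge Tab) ≡ M
  leavesOn-sum Tab = begin
    leavesOn Tab + leavesOn (reverseEdge Tab)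
      ≡⟨ cong (leavesOn Tab +_) (count-cong _ _ (λ k → onSide-flip Tab (reverseEdge Tab) (L k))) ⟩
    count (λ k → true ∧ onSide Tab (L k)) + count (λ k → true ∧ not (onSide Tab (L k)))
      ≡⟨ sym (count-split (λ _ → true) (λ k → onSide Tab (L k))) ⟩
    count {M} (λ _ → true)
      ≡⟨ count-all _ (λ _ → refl) ⟩
    M ∎
    where open ≡-Reasoning

  EvenEdge : Set
  EvenEdge = Σ (Fin t) λ a → Σ (Fin t) λ b → Σ (T a b ≡ true) λ Tab →
    M ≤ 3 * leavesOn Tab × M ≤ 3 * count (λ k → not (onSide Tab (L k)))

  evenEdge : ∀ {a b} (Tab : T a b ≡ true) →
    M ≤ 3 * leavesOn Tab → M ≤ 3 * leavesOn (reverseEdge Tab) → EvenEdge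
  evenEdge Tab M≤3a M≤3b = _ , _ , Tab , M≤3a ,
    subst (λ n → M ≤ 3 * n) (count-cong _ _ (λ k → onSide-flip Tab (reverseEdge Tab) (L k))) M≤3b

  leafSide : ∀ {a b x} → degree T b ≡ 1 → T b a ≡ true → Side b a x → x ≡ b
  leafSide deg≡1 Tba here = refl
  leafSide {a} {b} deg≡1 Tba (step (Tby , not-ba) _) with uniqueNeighbour b deg≡1
  ... | _ , _ , unique = ⊥-elim (not-ba (inj₁ (refl , trans (unique _ Tby) (sym (unique a Tba)))))

  leafSide-leaves : ∀ {a b} → degree T b ≡ 1 → (Tba : T b a ≡ true) → leavesOn Tba ≤ 1
  leafSide-leaves deg≡1 Tba = count-atMostOne _ (λ k k′ k∈ k′∈ → L-inj (trans
    (leafSide deg≡1 Tba (onSide⇒Side Tba _ k∈)) (sym (leafSide deg≡1 Tba (onSide⇒Side Tba _ k′∈)))))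

  leavesOn-split : ∀ {a b} (Tba : T b a ≡ true) → degree T b ≡ 3 → (N : OtherNeighbours b a) →
    let open OtherNeighbours N in
    leavesOn Tba ≤ leavesOn (reverseEdge Tbc) + leavesOn (reverseEdge Tbd)
  leavesOn-split {a} {b} Tba deg≡3 N = count-union _ _ _ λ k k∈ →
    Sum.map (Side⇒onSide (reverseEdge Tbc) (L k)) (Side⇒onSide (reverseEdge Tbd) (L k))
      (side-split neighbours (leaf≢b k) (onSide⇒Side Tba (L k) k∈))
    where
    open OtherNeighbours N
    leaf≢b : ∀ k → L k ≢ b
    leaf≢b k Lk≡b with trans (sym (L-leaf k)) (trans (cong (degree T) Lk≡b) deg≡3)
    ... | ()

  farSide-shrinks : ∀ {a b c} (Tba : T b a ≡ true) (Tbc : T b c ≡ true) → c ≢ a →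
    count (onSide (reverseEdge Tbc)) < count (onSide Tba)
  farSide-shrinks {a} {b} {c} Tba Tbc c≢a = count-strict _ _
    (λ x x∈ → Side⇒onSide Tba x (side-nested Tbc Tba c≢a (onSide⇒Side (reverseEdge Tbc) x x∈)))
    b (Side⇒onSide Tba b here) (otherSide⇒¬onSide (reverseEdge Tbc) b here)

  HeavyStep : Fin t → Fin t → Set
  HeavyStep b a = Σ (Fin t) λ c → Σ (T b c ≡ true) λ Tbc → c ≢ a × 2 * M < 3 * leavesOn (reverseEdge Tbc)

  heavyStep : ∀ {a b} (Tba : T b a ≡ true) → 2 * M < 3 * leavesOn Tba → EvenEdge ⊎ HeavyStep b a
  heavyStep {a} {b} Tba heavy with deg13 b
  ... | inj₁ deg≡1 = ⊥-elim (<⇒≱ heavy (begin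
    3 * leavesOn Tba  ≤⟨ *-monoʳ-≤ 3 (leafSide-leaves deg≡1 Tba) ⟩
    3                 ≤⟨ s≤s (s≤s (s≤s z≤n)) ⟩
    2 * 2             ≤⟨ *-monoʳ-≤ 2 2≤M ⟩
    2 * M             ∎))
    where open ≤-Reasoning
  ... | inj₂ deg≡3 = viaC (balance _ _ M (leavesOn-sum Tbc))
    where
    N : OtherNeighbours b a
    N = otherNeighbours b a deg≡3 Tba
    open OtherNeighbours N
    cSide dSide : ℕ
    cSide = leavesOn (reverseEdge Tbc)
    dSide = leavesOn (reverseEdge Tbd)
    bothLight : 3 * cSide < M → 3 * dSide < M → ⊥
    bothLight lightC lightD = <⇒≱ heavy (begin
      3 * leavesOn Tba         ≤⟨ *-monoʳ-≤ 3 (leavesOn-split Tba deg≡3 N) ⟩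
      3 * (cSide + dSide)      ≡⟨ *-distribˡ-+ 3 cSide dSide ⟩
      3 * cSide + 3 * dSide    ≤⟨ <⇒≤ (+-mono-< lightC lightD) ⟩
      M + M                    ≡⟨ cong (M +_) (sym (+-identityʳ M)) ⟩
      2 * M                    ∎)
      where open ≤-Reasoning
    viaD : 3 * cSide < M → Balance M (leavesOn Tbd) dSide → EvenEdge ⊎ HeavyStep b a
    viaD _      (farHeavy heavyD)    = inj₂ (d , Tbd , d≢a , heavyD)
    viaD _      (balanced M≤3 M≤3′) = inj₁ (evenEdge Tbd M≤3 M≤3′)
    viaD lightC (farLight lightD)    = ⊥-elim (bothLight lightC lightD)
    viaC : Balance M (leavesOn Tbc) cSide → EvenEdge ⊎ HeavyStep b a
    viaC (farHeavy heavyC)    = inj₂ (c , Tbc , c≢a , heavyC)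
    viaC (balanced M≤3 M≤3′) = inj₁ (evenEdge Tbc M≤3 M≤3′)
    viaC (farLight lightC)    = viaD lightC (balance _ _ M (leavesOn-sum Tbd))

  -- iterate heavy steps; the far side shrinks, so `fuel` bounds the walk
  walk : (fuel : ℕ) → ∀ {a b} (Tba : T b a ≡ true) → 2 * M < 3 * leavesOn Tba →
    count (onSide Tba) < fuel → EvenEdge
  walk (suc fuel) Tba heavy size<fuel with heavyStep Tba heavy
  ... | inj₁ even = even
  ... | inj₂ (c , Tbc , c≢a , heavyC) =
    walk fuel (reverseEdge Tbc) heavyC (≤-trans (farSide-shrinks Tba Tbc c≢a) (≤-pred size<fuel))

  evenEdgeExists : EvenEdge
  evenEdgeExists with uniqueNeighbour (L (fromℕ< 2≤M)) (L-leaf (fromℕ< 2≤M))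
  ... | b , Tℓb , _ = start (balance _ _ M (leavesOn-sum Tℓb))
    where
    start : Balance M (leavesOn Tℓb) (leavesOn (reverseEdge Tℓb)) → EvenEdge
    start (farHeavy heavy)    = walk (suc t) (reverseEdge Tℓb) heavy (s≤s (count≤ _))
    start (balanced M≤3 M≤3′) = evenEdge Tℓb M≤3 M≤3′
    start (farLight light)    =
      walk (suc t) Tℓb (farLight⇒nearHeavy (leavesOn Tℓb) _ M (leavesOn-sum Tℓb) light) (s≤s (count≤ _))

anyᵇ : ∀ {k} → (Fin k → Bool) → Bool
anyᵇ {zero}  f = false
anyᵇ {suc k} f = f zero ∨ anyᵇ (λ i → f (suc i))

anyᵇ-intro : ∀ {k} (f : Fin k → Bool) i → f i ≡ true → anyᵇ f ≡ true
anyᵇ-intro f zero    fi rewrite fi = refl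
anyᵇ-intro f (suc i) fi with f zero
... | true  = refl
... | false = anyᵇ-intro (λ j → f (suc j)) i fi

anyᵇ-elim : ∀ {k} (f : Fin k → Bool) → anyᵇ f ≡ true → ∃ λ i → f i ≡ true
anyᵇ-elim {suc k} f some with f zero in f0
... | true  = zero , f0
... | false with anyᵇ-elim (λ i → f (suc i)) some
...   | i , fi = suc i , fi

anyᵇ-none : ∀ {k} (f : Fin k → Bool) → anyᵇ f ≡ false → ∀ i → f i ≡ false
anyᵇ-none f none i with f i in fi
... | false = refl
... | true  with trans (sym (anyᵇ-intro f i fi)) none
...   | ()

CutRk≤-cong : ∀ {G : Graph} {X Y : Fin (size G) → Set} {r} →
  (∀ v → X v → Y v) → (∀ v → Y v → X v) → CutRk≤ G X r → CutRk≤ G Y r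
CutRk≤-cong X⊆Y Y⊆X rank≤r f f-inj f∈Y with rank≤r f f-inj (λ i → Y⊆X (f i) (f∈Y i))
... | c , nonzero , even = c , nonzero , (λ v v∉Y → even v (λ v∈X → v∉Y (X⊆Y v v∈X)))

-- Then at most
-- 2r lines are mixed: r+1 mixed lines with τ in X (resp. outside X) yield an
-- upper (resp. lower) triangular (r+1)×(r+1) submatrix across the cut.
module ThresholdLines (H : Graph) (inX : Fin (size H) → Bool) (r : ℕ)
  (rank≤r : CutRk≤ H (λ v → inX v ≡ true) r) {m : ℕ}
  (τ : Fin m → Fin (size H)) (line : Fin m → Fin m → Fin (size H))
  (τ-inj : Injective _≡_ _≡_ τ) (line-inj : ∀ {u u′ w w′} → line u w ≡ line u′ w′ → u ≡ u′)
  (τ-adj : ∀ s u w → E H (τ s) (line u w) ≡ le s u) where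

  hasIn hasOut mixed : Fin m → Bool
  hasIn  u = anyᵇ (λ w → inX (line u w))
  hasOut u = anyᵇ (λ w → not (inX (line u w)))
  mixed  u = hasIn u ∧ hasOut u

  cellIn : ∀ u → mixed u ≡ true → Σ (Fin m) λ w → inX (line u w) ≡ true
  cellIn u mixed-u = anyᵇ-elim _ (∧-conicalˡ (hasIn u) _ mixed-u)

  cellOut : ∀ u → mixed u ≡ true → Σ (Fin m) λ w → inX (line u w) ≡ false
  cellOut u mixed-u with anyᵇ-elim _ (∧-conicalʳ (hasIn u) _ mixed-u)
  ... | w , out = w , not-injective out

  mixedWithτIn : ¬ (suc r ≤ count (λ u → mixed u ∧ inX (τ u)))
  mixedWithτIn r<n with select _ (suc r) r<n
  ... | g , g↑ , selected = upperTriangular H _ r ρ κ ρ-inj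
    (λ s → ∧-conicalʳ (mixed (g s)) _ (selected s))
    (λ q κq∈X → false≢true (trans (sym (proj₂ (outCell q))) κq∈X))
    (λ s q → trans (τ-adj (g s) (g q) _) (increasing-le g↑ s q))
    rank≤r
    where
    outCell : ∀ q → Σ (Fin m) λ w → inX (line (g q) w) ≡ false
    outCell q = cellOut (g q) (∧-conicalˡ _ _ (selected q))
    ρ κ : Fin (suc r) → Fin (size H)
    ρ s = τ (g s)
    κ q = line (g q) (proj₁ (outCell q))
    ρ-inj : Injective _≡_ _≡_ ρ
    ρ-inj ρs≡ρs′ = increasing-injective g↑ (τ-inj ρs≡ρs′)

  mixedWithτOut : ¬ (suc r ≤ count (λ u → mixed u ∧ not (inX (τ u))))
  mixedWithτOut r<n with select _ (suc r) r<n
  ... | g , g↑ , selected = lowerTriangular H _ r ρ κ ρ-inj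
    (λ s → proj₂ (inCell s))
    (λ q κq∈X → false≢true (trans (sym (not-injective (∧-conicalʳ (mixed (g q)) _ (selected q)))) κq∈X))
    (λ s q → trans (Graph.sym H (ρ s) (κ q)) (trans (τ-adj (g q) (g s) _) (increasing-le g↑ q s)))
    rank≤r
    where
    inCell : ∀ s → Σ (Fin m) λ w → inX (line (g s) w) ≡ true
    inCell s = cellIn (g s) (∧-conicalˡ _ _ (selected s))
    ρ κ : Fin (suc r) → Fin (size H)
    ρ s = line (g s) (proj₁ (inCell s))
    κ q = τ (g q)
    ρ-inj : Injective _≡_ _≡_ ρ
    ρ-inj ρs≡ρs′ = increasing-injective g↑ (line-inj ρs≡ρs′)

  mixedLines≤ : count mixed ≤ 2 * r
  mixedLines≤ = begin
    count mixed
      ≡⟨ count-split mixed (λ u → inX (τ u)) ⟩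
    count (λ u → mixed u ∧ inX (τ u)) + count (λ u → mixed u ∧ not (inX (τ u)))
      ≤⟨ +-mono-≤ (≮⇒≥ mixedWithτIn) (≮⇒≥ mixedWithτOut) ⟩
    r + r
      ≡⟨ cong (r +_) (sym (+-identityʳ r)) ⟩
    2 * r ∎
    where open ≤-Reasoning

sumFin : ∀ {m} → (Fin m → ℕ) → ℕ
sumFin {zero}  f = 0
sumFin {suc m} f = f zero + sumFin (λ u → f (suc u))

sumFin-cong : ∀ {k} {f g : Fin k → ℕ} → (∀ u → f u ≡ g u) → sumFin f ≡ sumFin g
sumFin-cong {zero}  f≡g = refl
sumFin-cong {suc k} f≡g = cong₂ _+_ (f≡g zero) (sumFin-cong (λ u → f≡g (suc u)))

sumFin-mono : ∀ {k} {f g : Fin k → ℕ} → (∀ u → f u ≤ g u) → sumFin f ≤ sumFin g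
sumFin-mono {zero}  f≤g = z≤n
sumFin-mono {suc k} f≤g = +-mono-≤ (f≤g zero) (sumFin-mono (λ u → f≤g (suc u)))

sumFin-indicator : ∀ {k} (f : Fin k → Bool) n → sumFin (λ u → indicator (f u) * n) ≡ count f * n
sumFin-indicator {zero}  f n = refl
sumFin-indicator {suc k} f n =
  trans (cong (indicator (f zero) * n +_) (sumFin-indicator (λ u → f (suc u)) n))
        (sym (*-distribʳ-+ n (indicator (f zero)) (count (λ u → f (suc u)))))

count-++ : ∀ n k (h : Fin (n + k) → Bool) → count h ≡ count (λ i → h (i ↑ˡ k)) + count (λ j → h (n ↑ʳ j))
count-++ zero    k h = refl
count-++ (suc n) k h = trans (cong (indicator (h zero) +_) (count-++ n k (λ i → h (suc i))))
  (sym (+-assoc (indicator (h zero)) _ _))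

count-combine : ∀ m n (h : Fin (m * n) → Bool) →
  count h ≡ sumFin {m} (λ u → count {n} (λ w → h (combine u w)))
count-combine zero    n h = refl
count-combine (suc m) n h =
  trans (count-++ n (m * n) h)
        (cong (count (λ i → h (i ↑ˡ (m * n))) +_) (count-combine m n (λ j → h (n ↑ʳ j))))

-- Counting over an m×n grid, enumerated by Fin (m * n) via `remQuot`:
-- if only the rows flagged by `flag` contain true entries, the number of
-- true entries is at most (number of flagged rows)·n.
gridEntry : ∀ {m n} {A : Set} → (Fin m → Fin n → A) → Fin (m * n) → A
gridEntry {m} {n} Q k = Q (proj₁ (remQuot {m} n k)) (proj₂ (remQuot {m} n k))

countGrid≤ : ∀ {m n} (Q : Fin m → Fin n → Bool) (flag : Fin m → Bool) →
  (∀ u → anyᵇ (Q u) ≡ true → flag u ≡ true) → count (gridEntry Q) ≤ count flag * n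
countGrid≤ {m} {n} Q flag flagged = begin
  count (gridEntry Q)                    ≡⟨ count-combine m n (gridEntry Q) ⟩
  sumFin (λ u → count (λ w → gridEntry Q (combine {m} {n} u w)))
    ≡⟨ sumFin-cong (λ u → count-cong _ _ (λ w →
         cong (λ p → Q (proj₁ p) (proj₂ p)) (remQuot-combine {m} {n} u w))) ⟩
  sumFin (λ u → count (Q u))             ≤⟨ sumFin-mono rowBound ⟩
  sumFin (λ u → indicator (flag u) * n)  ≡⟨ sumFin-indicator flag n ⟩
  count flag * n                         ∎
  where
  open ≤-Reasoning
  rowBound : ∀ u → count (Q u) ≤ indicator (flag u) * n
  rowBound u with anyᵇ (Q u) in some
  ... | true  rewrite flagged u some = ≤-trans (count≤ (Q u)) (≤-reflexive (sym (+-identityʳ n)))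
  ... | false = subst (_≤ indicator (flag u) * n) (sym (count-none (Q u) (anyᵇ-none (Q u) some))) z≤n

record ThresholdGrid (H : Graph) (m : ℕ) : Set where
  field
    row col  : Fin m → Fin (size H)
    cell     : Fin m → Fin m → Fin (size H)
    row-inj  : Injective _≡_ _≡_ row
    col-inj  : Injective _≡_ _≡_ col
    cell-inj : ∀ {u u′ w w′} → cell u w ≡ cell u′ w′ → u ≡ u′ × w ≡ w′
    row-adj  : ∀ s u w → E H (row s) (cell u w) ≡ le s u
    col-adj  : ∀ s u w → E H (col s) (cell u w) ≡ le s w

-- At most 2r rows and 2r columns
-- are mixed.  If some row lies inside X and another outside, every column is
-- mixed, so m ≤ 2r.  Otherwise one side of the cut meets every row only in
-- mixed rows, so it has at most 2r·m cells, whereas it has at least m²/3.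
module EvenlyCutGrid {H : Graph} {m : ℕ} (Γ : ThresholdGrid H m) (inX : Fin (size H) → Bool) (r : ℕ)
  (rank≤r : CutRk≤ H (λ v → inX v ≡ true) r) (6r<m : 6 * r < m)
  (inside  : m * m ≤ 3 * count (gridEntry (λ u w → inX (ThresholdGrid.cell Γ u w))))
  (outside : m * m ≤ 3 * count (gridEntry (λ u w → not (inX (ThresholdGrid.cell Γ u w))))) where

  open ThresholdGrid Γ

  module Rows = ThresholdLines H inX r rank≤r row cell row-inj (λ same → proj₁ (cell-inj same)) row-adj
  module Cols = ThresholdLines H inX r rank≤r col (λ w u → cell u w) col-inj (λ same → proj₂ (cell-inj same))
    (λ s w u → col-adj s u w)

  oneSideInMixedRows : (Q : Fin m → Fin m → Bool) → m * m ≤ 3 * count (gridEntry Q) →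
    (∀ u → anyᵇ (Q u) ≡ true → Rows.mixed u ≡ true) → ⊥
  oneSideInMixedRows Q many inMixed = <-irrefl refl (begin-strict
    m * m                      ≤⟨ many ⟩
    3 * count (gridEntry Q)    ≤⟨ *-monoʳ-≤ 3 (countGrid≤ Q Rows.mixed inMixed) ⟩
    3 * (count Rows.mixed * m) ≤⟨ *-monoʳ-≤ 3 (*-monoˡ-≤ m Rows.mixedLines≤) ⟩
    3 * (2 * r * m)            ≡⟨ sym (*-assoc 3 (2 * r) m) ⟩
    3 * (2 * r) * m            ≡⟨ cong (_* m) (sym (*-assoc 3 2 r)) ⟩
    6 * r * m                  <⟨ *-monoˡ-< m ⦃ >-nonZero (≤-<-trans z≤n 6r<m) ⦄ 6r<m ⟩
    m * m                      ∎)
    where open ≤-Reasoning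

  rowsOnBothSides : (∃ λ u₀ → Rows.hasOut u₀ ≡ false) → (∃ λ u₁ → Rows.hasIn u₁ ≡ false) → ⊥
  rowsOnBothSides (u₀ , allIn) (u₁ , allOut) = <-irrefl refl (begin-strict
    m                ≡⟨ sym (count-all Cols.mixed everyColumnMixed) ⟩
    count Cols.mixed ≤⟨ Cols.mixedLines≤ ⟩
    2 * r            ≤⟨ *-monoˡ-≤ r (s≤s (s≤s (z≤n {4}))) ⟩
    6 * r            <⟨ 6r<m ⟩
    m                ∎)
    where
    open ≤-Reasoning
    everyColumnMixed : ∀ w → Cols.mixed w ≡ true
    everyColumnMixed w = cong₂ _∧_
      (anyᵇ-intro (λ u → inX (cell u w)) u₀
        (not-injective (anyᵇ-none (λ w′ → not (inX (cell u₀ w′))) allIn w)))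
      (anyᵇ-intro (λ u → not (inX (cell u w))) u₁
        (cong not (anyᵇ-none (λ w′ → inX (cell u₁ w′)) allOut w)))

  impossible : ⊥
  impossible with anyᵇ (λ u → not (Rows.hasOut u)) in someAllIn
                | anyᵇ (λ u → not (Rows.hasIn u)) in someAllOut
  ... | true  | true  = rowsOnBothSides (falseAt (anyᵇ-elim _ someAllIn)) (falseAt (anyᵇ-elim _ someAllOut))
    where
    falseAt : ∀ {b : Fin m → Bool} → (∃ λ u → not (b u) ≡ true) → ∃ λ u → b u ≡ false
    falseAt (u , not-bu) = u , not-injective not-bu
  ... | false | _     = oneSideInMixedRows _ inside λ u hasIn →
    cong₂ _∧_ hasIn (not-injective (anyᵇ-none _ someAllIn u))
  ... | true  | false = oneSideInMixedRows _ outside λ u hasOut →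
    cong₂ _∧_ (not-injective (anyᵇ-none _ someAllOut u)) hasOut

Fin≤1-unique : ∀ {k} → k ≤ 1 → (x y : Fin k) → x ≡ y
Fin≤1-unique (s≤s z≤n) zero zero = refl

-- A graph containing a threshold
-- grid of order m ≥ 2 has rank-width > r whenever 6r < m: any rank-
-- decomposition has an edge splitting the cells evenly (`BalancedEdge`), and
-- its cut has cut-rank > r (`EvenlyCutGrid`).
thresholdGrid⇒rankWidth> : ∀ {H : Graph} {m : ℕ} (r : ℕ) → ThresholdGrid H m → 2 ≤ m → 6 * r < m →
  ¬ RankWidth≤ H r
thresholdGrid⇒rankWidth> r Γ (s≤s (s≤s _)) 6r<m (inj₁ size≤1) =
  zero≢one (proj₂ (cell-inj (Fin≤1-unique size≤1 (cell zero zero) (cell zero (suc zero)))))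
  where
  open ThresholdGrid Γ
  zero≢one : ∀ {k} → Fin.zero {suc k} ≢ suc zero
  zero≢one ()
thresholdGrid⇒rankWidth> {H} {m} r Γ 2≤m 6r<m (inj₂ (D , width≤r)) with evenEdgeExists
  where
  open ThresholdGrid Γ
  L : Fin (m * m) → Fin (t D)
  L k = leaf D (gridEntry cell k)
  L-inj : ∀ {k k′} → L k ≡ L k′ → k ≡ k′
  L-inj {k} {k′} same with cell-inj (leaf-inj D same)
  ... | u≡u′ , w≡w′ =
    trans (sym (combine-remQuot {m} m k)) (trans (cong₂ combine u≡u′ w≡w′) (combine-remQuot {m} m k′))
  open BalancedEdge (T D) (T-sym D) (T-irr D) (connected D) (acyclic D) (deg13 D)
    (*-mono-≤ 2≤m (≤-trans (s≤s z≤n) 2≤m)) L L-inj (λ k → leaf-deg D _)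
... | a , b , Tab , inside , outside =
  EvenlyCutGrid.impossible Γ inX r rank≤r 6r<m inside outside
  where
  open TreeSides (T D) (T-sym D) (T-irr D) (connected D) (acyclic D)
  inX : Fin (size H) → Bool
  inX v = onSide Tab (leaf D v)
  rank≤r : CutRk≤ H (λ v → inX v ≡ true) r
  rank≤r = CutRk≤-cong {H} (λ v → Side⇒onSide Tab (leaf D v)) (λ v → onSide⇒Side Tab (leaf D v))
                           (width≤r a b Tab)

<ᵇ∨≡ᵇ≡≤ᵇ : ∀ x y → ((x <ᵇ y) ∨ ((x ≡ᵇ y) ∧ true)) ≡ (x ≤ᵇ y)
<ᵇ∨≡ᵇ≡≤ᵇ zero          zero    = refl
<ᵇ∨≡ᵇ≡≤ᵇ zero          (suc y) = refl
<ᵇ∨≡ᵇ≡≤ᵇ (suc x)       zero    = refl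
<ᵇ∨≡ᵇ≡≤ᵇ (suc zero)    (suc y) = <ᵇ∨≡ᵇ≡≤ᵇ zero y
<ᵇ∨≡ᵇ≡≤ᵇ (suc (suc x)) (suc y) = <ᵇ∨≡ᵇ≡≤ᵇ (suc x) y

-- A twisted chain graph of order n contains a threshold grid of order n:
-- rows v_(x,1), columns w_(y,1) and cells z_(i,j).  (With second index 1,
-- v_(x,1) ~ z_(i,j) iff x ≤ i and w_(y,1) ~ z_(i,j) iff y ≤ j.)
twistedChainGrid : ∀ {n G} → 1 ≤ n → IsTwistedChainGraph n G → ThresholdGrid G n
twistedChainGrid {n} {G} 1≤n (φ , φ-inj , _ , adjA , adjB) = record
  { row = λ x → φ (vA x first) ; col = λ y → φ (wB y first) ; cell = λ i j → φ (zC i j)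
  ; row-inj = λ same → vA-injective (φ-inj same) ; col-inj = λ same → wB-injective (φ-inj same)
  ; cell-inj = λ same → zC-injective (φ-inj same)
  ; row-adj = λ x i j → trans (adjA x first i j) (threshold x i j)
  ; col-adj = λ y i j → trans (adjB y first i j) (threshold y j i) }
  where
  first : Fin n
  first = fromℕ< 1≤n
  threshold : ∀ x i j → (lt x i ∨ (eq x i ∧ le first j)) ≡ le x i
  threshold x i j rewrite toℕ-fromℕ< 1≤n = <ᵇ∨≡ᵇ≡≤ᵇ (toℕ x) (toℕ i)
  vA-injective : ∀ {x x′ y y′ : Fin n} → vA x y ≡ vA x′ y′ → x ≡ x′
  vA-injective refl = refl
  wB-injective : ∀ {x x′ y y′ : Fin n} → wB x y ≡ wB x′ y′ → x ≡ x′
  wB-injective refl = refl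
  zC-injective : ∀ {x x′ y y′ : Fin n} → zC x y ≡ zC x′ y′ → x ≡ x′ × y ≡ y′
  zC-injective refl = refl , refl

restrictGrid : ∀ {G m n} → ThresholdGrid G n → (g h : Fin m → Fin n) → Increasing g → Increasing h →
  ThresholdGrid G m
restrictGrid Γ g h g↑ h↑ = record
  { row = λ s → row (g s) ; col = λ s → col (h s) ; cell = λ u w → cell (g u) (h w)
  ; row-inj = λ same → increasing-injective g↑ (row-inj same)
  ; col-inj = λ same → increasing-injective h↑ (col-inj same)
  ; cell-inj = λ same → let (u≡ , w≡) = cell-inj same
                        in increasing-injective g↑ u≡ , increasing-injective h↑ w≡
  ; row-adj = λ s u w → trans (row-adj (g s) (g u) (h w)) (increasing-le g↑ s u)
  ; col-adj = λ s u w → trans (col-adj (h s) (g u) (h w)) (increasing-le h↑ s w) }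
  where open ThresholdGrid Γ

inducedGrid : ∀ {G m k} (Γ : ThresholdGrid G m) (f : Fin k → Fin (size G)) (P : Fin (size G) → Set) →
  (∀ v → P v → ∃ λ u → f u ≡ v) →
  (∀ s → P (ThresholdGrid.row Γ s)) → (∀ s → P (ThresholdGrid.col Γ s)) →
  (∀ u w → P (ThresholdGrid.cell Γ u w)) → ThresholdGrid (induced G f) m
inducedGrid {G} {m} {k} Γ f P preimage P-row P-col P-cell = record
  { row = λ s → lift (P-row s) ; col = λ s → lift (P-col s) ; cell = λ u w → lift (P-cell u w)
  ; row-inj = λ same → row-inj (lift-injective same) ; col-inj = λ same → col-inj (lift-injective same)
  ; cell-inj = λ same → cell-inj (lift-injective same)
  ; row-adj = λ s u w → trans (cong₂ (E G) (lift-correct (P-row s)) (lift-correct (P-cell u w)))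
                              (row-adj s u w)
  ; col-adj = λ s u w → trans (cong₂ (E G) (lift-correct (P-col s)) (lift-correct (P-cell u w)))
                              (col-adj s u w) }
  where
  open ThresholdGrid Γ
  lift : ∀ {v} → P v → Fin k
  lift {v} Pv = proj₁ (preimage v Pv)
  lift-correct : ∀ {v} (Pv : P v) → f (lift Pv) ≡ v
  lift-correct {v} Pv = proj₂ (preimage v Pv)
  lift-injective : ∀ {v v′} {Pv : P v} {Pv′ : P v′} → lift Pv ≡ lift Pv′ → v ≡ v′
  lift-injective {Pv = Pv} {Pv′} same =
    trans (sym (lift-correct Pv)) (trans (cong f same) (lift-correct Pv′))

record MonochromaticGrid (G : Graph) {NC : ℕ} (colour : Fin (size G) → Fin NC) (m : ℕ) : Set where
  field
    grid : ThresholdGrid G m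
    cellColour rowColour colColour : Fin NC
  open ThresholdGrid grid public
  field
    cell-colour : ∀ u w → colour (cell u w) ≡ cellColour
    row-colour  : ∀ s → colour (row s) ≡ rowColour
    col-colour  : ∀ s → colour (col s) ≡ colColour

-- the order of grid from which Ramsey extracts a monochromatic m×m subgrid
ramseyOrder : ℕ → ℕ → ℕ
ramseyOrder K m = K * m + K ^ (K * m) * m

combine₃ : ∀ {NC} → Fin NC → Fin NC → Fin NC → Fin (NC * NC * NC)
combine₃ a b c = combine (combine a b) c

combine₃-injective : ∀ {NC} {a b c a′ b′ c′ : Fin NC} → combine₃ a b c ≡ combine₃ a′ b′ c′ →
  a ≡ a′ × b ≡ b′ × c ≡ c′
combine₃-injective {NC} {a} {b} {c} {a′} {b′} {c′} same
  with combine-injective {NC * NC} {NC} (combine a b) c (combine a′ b′) c′ same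
... | ab≡ , c≡ with combine-injective a b a′ b′ ab≡
...   | a≡ , b≡ = a≡ , b≡ , c≡

-- Any NC-colouring of a threshold grid of order ramseyOrder K m, m ≥ 1, has a
-- monochromatic threshold subgrid of order m, given an injective encoding of
-- triples of colours into K colours: colour each cell (t, j) of the
-- (rows × columns) part by the triple (colour of the cell, of row t, of
-- column j) and apply bipartite Ramsey.
monochromaticGrid : ∀ {G : Graph} {NC : ℕ} (K m : ℕ) .⦃ _ : NonZero K ⦄
  (colour : Fin (size G) → Fin NC) (pack : Fin NC → Fin NC → Fin NC → Fin K) →
  (∀ {a b c a′ b′ c′} → pack a b c ≡ pack a′ b′ c′ → a ≡ a′ × b ≡ b′ × c ≡ c′) →
  ThresholdGrid G (ramseyOrder K (suc m)) → MonochromaticGrid G colour (suc m)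
monochromaticGrid {G} {NC} K m colour pack pack-injective Γ = record
  { grid = restrictGrid Γ (λ s → rows s ↑ˡ C) (λ s → R ↑ʳ cols s)
             (increasing-∘ (↑ˡ-increasing C) rows-increasing) (increasing-∘ (↑ʳ-increasing R) cols-increasing)
  ; cellColour = colourOfCell (rows zero) (cols zero)
  ; rowColour  = colourOfRow (rows zero)
  ; colColour  = colourOfCol (cols zero)
  ; cell-colour = λ u w → proj₁ (sameColours u w)
  ; row-colour  = λ s → proj₁ (proj₂ (sameColours s zero))
  ; col-colour  = λ s → proj₂ (proj₂ (sameColours zero s)) }
  where
  open ThresholdGrid Γ
  R C : ℕ
  R = K * suc m
  C = K ^ R * suc m
  colourOfCell : Fin R → Fin C → Fin NC
  colourOfCell t j = colour (cell (t ↑ˡ C) (R ↑ʳ j))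
  colourOfRow : Fin R → Fin NC
  colourOfRow t = colour (row (t ↑ˡ C))
  colourOfCol : Fin C → Fin NC
  colourOfCol j = colour (col (R ↑ʳ j))
  triple : Fin R → Fin C → Fin K
  triple t j = pack (colourOfCell t j) (colourOfRow t) (colourOfCol j)
  open MonochromaticSubgrid (bipartiteRamsey K (suc m) triple)
  sameColours : ∀ s u →
    colourOfCell (rows s) (cols u) ≡ colourOfCell (rows zero) (cols zero) ×
    colourOfRow (rows s) ≡ colourOfRow (rows zero) × colourOfCol (cols u) ≡ colourOfCol (cols zero)
  sameColours s u = pack-injective (trans (monochromatic s u) (sym (monochromatic zero zero)))

GoodColouring : (G : Graph) (N p : ℕ) (Q : ℕ → ℕ) → (Fin (size G) → Fin N) → Set
GoodColouring G N p Q colour =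
  ∀ (i : ℕ) → i ≤ p → (I : Fin i → Fin N) → Injective _≡_ _≡_ I →
  ∀ (m : ℕ) (f : Fin m → Fin (size G)) → Injective _≡_ _≡_ f →
  (∀ u → ∃ λ j → colour (f u) ≡ I j) →
  (∀ v → (∃ λ j → colour v ≡ I j) → ∃ λ u → f u ≡ v) →
  RankWidth≤ (induced G f) (Q i)

distinctEntries : ∀ {N} (L : List (Fin N)) → Σ ℕ λ i → i ≤ length L × Σ (Fin i → Fin N) λ I →
  Injective _≡_ _≡_ I × (∀ κ → κ ∈ L → ∃ λ j → κ ≡ I j)
distinctEntries [] = 0 , z≤n , (λ ()) , (λ { {()} }) , (λ κ ())
distinctEntries {N} (κ₀ ∷ L) with distinctEntries L
... | i , i≤ , I , I-inj , listed with any? (λ j → κ₀ ≟ᶠ I j)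
...   | yes (j₀ , κ₀≡) = i , m≤n⇒m≤1+n i≤ , I , I-inj , listed′
  where
  listed′ : ∀ κ → κ ∈ κ₀ ∷ L → ∃ λ j → κ ≡ I j
  listed′ κ (here refl)  = j₀ , κ₀≡
  listed′ κ (there κ∈L) = listed κ κ∈L
...   | no κ₀-new = suc i , s≤s i≤ , I′ , I′-inj , listed′
  where
  I′ : Fin (suc i) → Fin N
  I′ zero    = κ₀
  I′ (suc j) = I j
  I′-inj : Injective _≡_ _≡_ I′
  I′-inj {zero}  {zero}  _    = refl
  I′-inj {zero}  {suc j} same = ⊥-elim (κ₀-new (j , same))
  I′-inj {suc j} {zero}  same = ⊥-elim (κ₀-new (j , sym same))
  I′-inj {suc j} {suc k} same = cong suc (I-inj same)
  listed′ : ∀ κ → κ ∈ κ₀ ∷ L → ∃ λ j → κ ≡ I′ j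
  listed′ κ (here refl)  = zero , refl
  listed′ κ (there κ∈L) with listed κ κ∈L
  ... | j , κ≡ = suc j , κ≡

record ColourClassUnion (G : Graph) {N : ℕ} (colour : Fin (size G) → Fin N) (L : List (Fin N))
  (Q : ℕ → ℕ) : Set where
  field
    classes   : ℕ
    classes≤  : classes ≤ length L
    order     : ℕ
    embedding : Fin order → Fin (size G)
    covers    : ∀ v → colour v ∈ L → ∃ λ u → embedding u ≡ v
    rankWidth : RankWidth≤ (induced G embedding) (Q classes)

colourClassUnion : ∀ {G N p Q} {colour : Fin (size G) → Fin N} → GoodColouring G N p Q colour →
  (L : List (Fin N)) → length L ≤ p → ColourClassUnion G colour L Q
colourClassUnion {G} {colour = colour} good L L≤p with distinctEntries L
... | i , i≤ , I , I-inj , listed = record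
  { classes = i ; classes≤ = i≤ ; order = count inUnion ; embedding = at
  ; covers = λ v colour∈L → onto v (coloured (listed (colour v) colour∈L))
  ; rankWidth = good i (≤-trans i≤ L≤p) I I-inj (count inUnion) at (increasing-injective increasing)
                     (λ u → uncoloured (member u)) (λ v has → onto v (coloured has)) }
  where
  inUnion : Fin (size G) → Bool
  inUnion v = anyᵇ (λ j → hasColour colour (I j) v)
  coloured : ∀ {v} → (∃ λ j → colour v ≡ I j) → inUnion v ≡ true
  coloured {v} (j , colour≡) = anyᵇ-intro _ j (≡⇒hasColour colour (I j) v colour≡)
  uncoloured : ∀ {v} → inUnion v ≡ true → ∃ λ j → colour v ≡ I j
  uncoloured {v} inU with anyᵇ-elim _ inU
  ... | j , has = j , hasColour⇒≡ colour (I j) v has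
  open Enumeration (enumerate inUnion)

sumUpTo : (ℕ → ℕ) → ℕ → ℕ
sumUpTo Q zero    = Q zero
sumUpTo Q (suc p) = Q (suc p) + sumUpTo Q p

sumUpTo-bound : ∀ Q {i p} → i ≤ p → Q i ≤ sumUpTo Q p
sumUpTo-bound Q {p = zero}  z≤n = ≤-refl
sumUpTo-bound Q {p = suc p} i≤1+p with m≤n⇒m<n∨m≡n i≤1+p
... | inj₁ i<1+p = ≤-trans (sumUpTo-bound Q (≤-pred i<1+p)) (m≤n+m (sumUpTo Q p) (Q (suc p)))
... | inj₂ refl  = m≤m+n (Q (suc p)) (sumUpTo Q p)

-- Take the order so that Ramsey yields
-- a monochromatic threshold grid of order m > 6·(Q 0 + … + Q 3); the at most
-- three colours on it induce a subgraph of rank-width ≤ Q i containing the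
-- grid, contradicting `thresholdGrid⇒rankWidth>`.
largeTwistedChainsDefeatColourings : ∀ (NC : ℕ) (Q : ℕ → ℕ) → Σ ℕ λ n → 1 ≤ n ×
  ∀ G → IsTwistedChainGraph n G → (colour : Fin (size G) → Fin NC) → ¬ GoodColouring G NC 3 Q colour
largeTwistedChainsDefeatColourings zero Q = 1 , ≤-refl , noColours
  where
  noColours : ∀ G → IsTwistedChainGraph 1 G → (colour : Fin (size G) → Fin zero) → ¬ GoodColouring G zero 3 Q colour
  noColours G (φ , _) colour _ with colour (φ (zC zero zero))
  ... | ()
largeTwistedChainsDefeatColourings (suc N′) Q = ramseyOrder K m , s≤s z≤n , defeat
  where
  K m′ m : ℕ
  K  = suc N′ * suc N′ * suc N′
  m′ = suc (6 * sumUpTo Q 3)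
  m  = suc m′
  defeat : ∀ G → IsTwistedChainGraph (ramseyOrder K m) G → (colour : Fin (size G) → Fin (suc N′)) →
    ¬ GoodColouring G (suc N′) 3 Q colour
  defeat G twisted colour good =
    thresholdGrid⇒rankWidth> {induced G embedding} (Q classes) gridInUnion (s≤s (s≤s z≤n)) 6Q<m rankWidth
    where
    open MonochromaticGrid (monochromaticGrid {G} K m′ colour combine₃ combine₃-injective
                             (twistedChainGrid {G = G} (s≤s z≤n) twisted))
    gridColours : List (Fin (suc N′))
    gridColours = cellColour ∷ rowColour ∷ colColour ∷ []
    open ColourClassUnion (colourClassUnion {G} good gridColours ≤-refl)
    gridInUnion : ThresholdGrid (induced G embedding) m
    gridInUnion = inducedGrid {G} grid embedding (λ v → colour v ∈ gridColours) covers
      (λ s → there (here (row-colour s))) (λ s → there (there (here (col-colour s))))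
      (λ u w → here (cell-colour u w))
    6Q<m : 6 * Q classes < m
    6Q<m = s≤s (m≤n⇒m≤1+n (*-monoʳ-≤ 6 (sumUpTo-bound Q classes≤)))

-- Theorem 6: a hereditary class containing twisted chain graphs of every
-- order admits no low rank-width colourings.
theorem6 : (𝒞 : GraphClass) → Hereditary 𝒞 →
    (∀ (n : ℕ) → 1 ≤ n → Σ Graph (λ G → 𝒞 G × IsTwistedChainGraph n G)) →
    ¬ AdmitsLowRankWidthColorings 𝒞
theorem6 𝒞 _ twistedChains (N , Q , colouring)
  with largeTwistedChainsDefeatColourings (N 3) Q
... | n , 1≤n , defeat with twistedChains n 1≤n
...   | G , G∈𝒞 , twisted = defeat G twisted (proj₁ (colouring 3 G G∈𝒞)) (proj₂ (colouring 3 G G∈𝒞))
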